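{- For every positive integer $n$, $|B_n(132,213)|=|B_n(213,231)|=|B_n(231,312)|=|B_n(132,312)|$.
   Context: A permutation $\sigma\in S_n$ is written as $\sigma(1)\cdots\sigma(n)$. An index $i\in[n-1]$ is an ascent if $\sigma(i)<\sigma(i+1)$ and a descent if $\sigma(i)>\sigma(i+1)$. A ballot permutation is a permutation such that every prefix $\sigma(1)\cdots\sigma(p)$ has at least as many ascents as descents. $\sigma$ contains a pattern $\pi\in S_k$ if some subsequence $\sigma(c_1)\cdots\sigma(c_k)$ with $c_1<\dots<c_k$ is order-isomorphic to $\pi$, and avoids $\pi$ otherwise. $B_n(\pi_1,\dots,\pi_m)$ denotes the set of ballot permutations of length $n$ avoiding all of $\pi_1,\dots,\pi_m$. Two sets of patterns are called Wilf-equivalent (for ballot permutations) if the corresponding sets $B_n(\cdot)$ have equal cardinality for every $n$. -}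

module Defs where

open import Data.Nat using (ℕ; zero; suc; _+_; _≤_; _<_; _<ᵇ_)
open import Data.Fin using (Fin; toℕ) renaming (_<_ to _<ᶠ_)
open import Data.Bool using (Bool; true; false; if_then_else_)
open import Data.List using (List; []; _∷_; take; length)
open import Data.Vec using (Vec; lookup; toList; []; _∷_)
import Data.Vec
open import Data.Product using (Σ; ∃; _×_)
open import Function.Definitions using (Injective)
open import Function.Bundles using (_⇔_; _↔_)
open import Relation.Binary.PropositionalEquality using (_≡_)
open import Relation.Nullary using (¬_)

-- A permutation of length n: an injective map [n] → [n]
-- (σ(1)…σ(n) is the one-line notation, 0-indexed here).
-- We store the one-line notation as a vector; the injectivity proof is
-- irrelevant, so two permutations are equal iff their words are.
record Perm (n : ℕ) : Set where
  constructor perm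
  field
    fun : Vec (Fin n) n
    .inj : Injective _≡_ _≡_ (lookup fun)
open Perm public

word : ∀ {n} → Perm n → List ℕ
word σ = toList (Data.Vec.map toℕ (fun σ))

asc : List ℕ → ℕ
asc [] = 0
asc (x ∷ []) = 0
asc (x ∷ y ∷ ys) = (if x <ᵇ y then 1 else 0) + asc (y ∷ ys)

desc : List ℕ → ℕ
desc [] = 0
desc (x ∷ []) = 0
desc (x ∷ y ∷ ys) = (if y <ᵇ x then 1 else 0) + desc (y ∷ ys)

Ballot : ∀ {n} → Perm n → Set
Ballot σ = ∀ (p : ℕ) → desc (take p (word σ)) ≤ asc (take p (word σ))

Contains : ∀ {n k} → Perm n → Perm k → Set
Contains {n} {k} σ π =
  Σ (Fin k → Fin n) λ c →
    (∀ i j → i <ᶠ j → c i <ᶠ c j) ×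
    (∀ i j → (lookup (fun π) i <ᶠ lookup (fun π) j)
             ⇔ (lookup (fun σ) (c i) <ᶠ lookup (fun σ) (c j)))

Avoids : ∀ {n k} → Perm n → Perm k → Set
Avoids σ π = ¬ Contains σ π

-- patterns of length 3 from their one-line notation (1-based digits)
open import Data.Fin using (zero; suc)
open import Data.Product using (_,_)

private
  F3 = Fin 3
  f1 f2 f3 : F3
  f1 = zero
  f2 = suc zero
  f3 = suc (suc zero)

mk3 : F3 → F3 → F3 → Vec (Fin 3) 3
mk3 a b c = a ∷ b ∷ c ∷ []

open import Relation.Binary.PropositionalEquality using (refl)

inj132 : Injective _≡_ _≡_ (lookup (mk3 f1 f3 f2))
inj132 {zero} {zero} _ = refl
inj132 {suc zero} {suc zero} _ = refl
inj132 {suc (suc zero)} {suc (suc zero)} _ = refl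
inj132 {zero} {suc zero} ()
inj132 {zero} {suc (suc zero)} ()
inj132 {suc zero} {zero} ()
inj132 {suc zero} {suc (suc zero)} ()
inj132 {suc (suc zero)} {zero} ()
inj132 {suc (suc zero)} {suc zero} ()

inj213 : Injective _≡_ _≡_ (lookup (mk3 f2 f1 f3))
inj213 {zero} {zero} _ = refl
inj213 {suc zero} {suc zero} _ = refl
inj213 {suc (suc zero)} {suc (suc zero)} _ = refl
inj213 {zero} {suc zero} ()
inj213 {zero} {suc (suc zero)} ()
inj213 {suc zero} {zero} ()
inj213 {suc zero} {suc (suc zero)} ()
inj213 {suc (suc zero)} {zero} ()
inj213 {suc (suc zero)} {suc zero} ()

inj231 : Injective _≡_ _≡_ (lookup (mk3 f2 f3 f1))
inj231 {zero} {zero} _ = refl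
inj231 {suc zero} {suc zero} _ = refl
inj231 {suc (suc zero)} {suc (suc zero)} _ = refl
inj231 {zero} {suc zero} ()
inj231 {zero} {suc (suc zero)} ()
inj231 {suc zero} {zero} ()
inj231 {suc zero} {suc (suc zero)} ()
inj231 {suc (suc zero)} {zero} ()
inj231 {suc (suc zero)} {suc zero} ()

inj312 : Injective _≡_ _≡_ (lookup (mk3 f3 f1 f2))
inj312 {zero} {zero} _ = refl
inj312 {suc zero} {suc zero} _ = refl
inj312 {suc (suc zero)} {suc (suc zero)} _ = refl
inj312 {zero} {suc zero} ()
inj312 {zero} {suc (suc zero)} ()
inj312 {suc zero} {zero} ()
inj312 {suc zero} {suc (suc zero)} ()
inj312 {suc (suc zero)} {zero} ()
inj312 {suc (suc zero)} {suc zero} ()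

p132 p213 p231 p312 : Perm 3
p132 = perm (mk3 f1 f3 f2) inj132
p213 = perm (mk3 f2 f1 f3) inj213
p231 = perm (mk3 f2 f3 f1) inj231
p312 = perm (mk3 f3 f1 f2) inj312

-- B_n(π₁, π₂): ballot permutations of length n avoiding π₁ and π₂
-- (membership proofs are irrelevant: elements are determined by σ)
record B (n : ℕ) (π₁ π₂ : Perm 3) : Set where
  constructor mkB
  field
    perm-of : Perm n
    .ballot : Ballot perm-of
    .avoid₁ : Avoids perm-of π₁
    .avoid₂ : Avoids perm-of π₂

_≈ᶜ_ : Set → Set → Set
X ≈ᶜ Y = X ↔ Y

-- A permutation avoiding 231 that begins with an ascent begins with its minimum, and one
-- avoiding 132 begins with σ(1), σ(1)+1; a permutation avoiding 213 that begins with a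
-- descent begins with its maximum, and one avoiding 312 begins with σ(2)+1, σ(2).  So in
-- each of the four classes Av(α, β) with α ∈ {231, 132} and β ∈ {213, 312} a permutation
-- is determined by its up-down word: the first step and the standardised rest fix the
-- first letter.  Conversely every word is realised, as the first letter so chosen never
-- takes part in an occurrence of α or β.  Being ballot depends only on the up-down word,
-- so each B_n(α, β) is in bijection with the ballot words of length n - 1.

module Submission where

open import Defs
open import Data.Bool using (Bool; true; false; if_then_else_)
open import Data.Empty using (⊥; ⊥-elim)
open import Data.Fin as F using (Fin; toℕ; zero; suc; punchIn; punchOut; inject₁; fromℕ)
import Data.Fin.Properties as FP
open import Data.List using (List; []; _∷_; take)
open import Data.Nat as ℕ using (ℕ; zero; suc; _+_; _≤_; _<_; _<ᵇ_; z≤n; z<s; s<s)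
import Data.Nat.Properties as ℕP
open import Data.Product using (Σ; ∃; _×_; _,_; proj₁; proj₂)
open import Data.Sum using (_⊎_; inj₁; inj₂)
open import Data.Vec as V using (Vec; []; _∷_; lookup; toList; tabulate)
import Data.Vec.Properties as VP
open import Data.Vec.Relation.Unary.Linked using (Linked; []; [-]; _∷_; linked?)
open import Function using (_∘_; _⇔_; mk⇔; Equivalence; _↔_; mk↔ₛ′)
open import Function.Properties.Inverse using (↔-sym; ↔-trans)
open import Function.Definitions using (Injective)
open import Relation.Binary using (tri<; tri≈; tri>)
open import Relation.Binary.PropositionalEquality
open import Relation.Nullary using (¬_; yes; no; ofʸ; ofⁿ)
open import Relation.Nullary.Decidable using (recompute; ¬?; decidable-stable)

-- Ballot permutations and ballot words

upDown : ∀ {m} → Vec ℕ (suc m) → Vec Bool m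
upDown (x ∷ []) = []
upDown (x ∷ y ∷ ys) = (x <ᵇ y) ∷ upDown (y ∷ ys)

upDownᶠ : ∀ {n m} → Vec (Fin n) (suc m) → Vec Bool m
upDownᶠ f = upDown (V.map toℕ f)

ups downs : List Bool → ℕ
ups [] = 0
ups (b ∷ bs) = (if b then 1 else 0) + ups bs
downs [] = 0
downs (b ∷ bs) = (if b then 0 else 1) + downs bs

IsBallotWord : ∀ {m} → Vec Bool m → Set
IsBallotWord w = ∀ p → downs (take p (toList w)) ≤ ups (take p (toList w))

<ᵇ-cong : ∀ {a b c d} → (a < b → c < d) → (c < d → a < b) → (a <ᵇ b) ≡ (c <ᵇ d)
<ᵇ-cong {a} {b} {c} {d} f g
  with a <ᵇ b | ℕP.<ᵇ-reflects-< a b | c <ᵇ d | ℕP.<ᵇ-reflects-< c d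
... | true  | _      | true  | _      = refl
... | false | _      | false | _      = refl
... | true  | ofʸ p  | false | ofⁿ ¬q = ⊥-elim (¬q (f p))
... | false | ofⁿ ¬p | true  | ofʸ q  = ⊥-elim (¬p (g q))

<ᵇ-true : ∀ {a b} → a < b → (a <ᵇ b) ≡ true
<ᵇ-true {a} {b} p with a <ᵇ b | ℕP.<ᵇ-reflects-< a b
... | true  | _      = refl
... | false | ofⁿ ¬p = ⊥-elim (¬p p)

<ᵇ-false : ∀ {a b} → ¬ a < b → (a <ᵇ b) ≡ false
<ᵇ-false {a} {b} ¬p with a <ᵇ b | ℕP.<ᵇ-reflects-< a b
... | true  | ofʸ p = ⊥-elim (¬p p)
... | false | _     = refl

descent-bit : ∀ {x y} → x ≢ y → (if y <ᵇ x then 1 else 0) ≡ (if x <ᵇ y then 0 else 1)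
descent-bit {x} {y} x≢y with ℕP.<-cmp x y
... | tri< x<y _ y≮x rewrite <ᵇ-true x<y | <ᵇ-false y≮x = refl
... | tri≈ _ x≡y _   = ⊥-elim (x≢y x≡y)
... | tri> x≮y _ y<x rewrite <ᵇ-true y<x | <ᵇ-false x≮y = refl

asc-take : ∀ {m} (v : Vec ℕ (suc m)) p →
           asc (take (suc p) (toList v)) ≡ ups (take p (toList (upDown v)))
asc-take (x ∷ [])     zero    = refl
asc-take (x ∷ [])     (suc p) = refl
asc-take (x ∷ y ∷ ys) zero    = refl
asc-take (x ∷ y ∷ ys) (suc p) = cong ((if x <ᵇ y then 1 else 0) +_) (asc-take (y ∷ ys) p)

desc-take : ∀ {m} (v : Vec ℕ (suc m)) → Linked _≢_ v → ∀ p →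
            desc (take (suc p) (toList v)) ≡ downs (take p (toList (upDown v)))
desc-take (x ∷ [])     _           zero    = refl
desc-take (x ∷ [])     _           (suc p) = refl
desc-take (x ∷ y ∷ ys) _           zero    = refl
desc-take (x ∷ y ∷ ys) (x≢y ∷ ds) (suc p) = cong₂ _+_ (descent-bit x≢y) (desc-take (y ∷ ys) ds p)

injective⇒linked≢ : ∀ {k n} (f : Vec (Fin k) n) → Injective _≡_ _≡_ (lookup f) →
                    Linked _≢_ (V.map toℕ f)
injective⇒linked≢ []           _   = []
injective⇒linked≢ (x ∷ [])     _   = [-]
injective⇒linked≢ (x ∷ y ∷ ys) inj =
  (λ e → FP.0≢1+n (inj {zero} {suc zero} (FP.toℕ-injective e))) ∷
  injective⇒linked≢ (y ∷ ys) (FP.suc-injective ∘ inj)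

adjacent-distinct : ∀ {n} (σ : Perm n) → Linked _≢_ (V.map toℕ (fun σ))
adjacent-distinct (perm f f-inj) =
  recompute (linked? (λ x y → ¬? (x ℕ.≟ y)) _) (injective⇒linked≢ f f-inj)

ballot⇔ : ∀ {m} (σ : Perm (suc m)) → Ballot σ ⇔ IsBallotWord (upDownᶠ (fun σ))
ballot⇔ σ = mk⇔ to from
  where
  v = V.map toℕ (fun σ)
  to : Ballot σ → IsBallotWord (upDownᶠ (fun σ))
  to bal p = subst₂ _≤_ (desc-take v (adjacent-distinct σ) p) (asc-take v p) (bal (suc p))
  from : IsBallotWord (upDownᶠ (fun σ)) → Ballot σ
  from bal zero    = z≤n
  from bal (suc p) = subst₂ _≤_ (sym (desc-take v (adjacent-distinct σ) p)) (sym (asc-take v p)) (bal p)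

-- Length-3 patterns as chains of positions

pick : ∀ {A : Set} → A → A → A → Fin 3 → A
pick x y z zero             = x
pick x y z (suc zero)       = y
pick x y z (suc (suc zero)) = z

pick-map : ∀ {A B : Set} (g : A → B) {x y z} p → g (pick x y z p) ≡ pick (g x) (g y) (g z) p
pick-map g zero             = refl
pick-map g (suc zero)       = refl
pick-map g (suc (suc zero)) = refl

pick-eta : ∀ {A : Set} (g : Fin 3 → A) p → g p ≡ pick (g zero) (g (suc zero)) (g (suc (suc zero))) p
pick-eta g zero             = refl
pick-eta g (suc zero)       = refl
pick-eta g (suc (suc zero)) = refl

pick-mono : ∀ {x y z} → x < y → y < z → ∀ u v → u F.< v → pick x y z u < pick x y z v
pick-mono x<y y<z zero             (suc zero)       _ = x<y
pick-mono x<y y<z zero             (suc (suc zero)) _ = ℕP.<-trans x<y y<z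
pick-mono x<y y<z (suc zero)       (suc (suc zero)) _ = y<z
pick-mono _   _   zero             zero             ()
pick-mono _   _   (suc zero)       zero             ()
pick-mono _   _   (suc zero)       (suc zero)       (s<s ())
pick-mono _   _   (suc (suc zero)) zero             ()
pick-mono _   _   (suc (suc zero)) (suc zero)       (s<s ())
pick-mono _   _   (suc (suc zero)) (suc (suc zero)) (s<s (s<s ()))

-- A chain (a , b , d) lists the positions of a pattern in increasing order of value.
Chain : Set
Chain = Fin 3 × Fin 3 × Fin 3

record IsChainOf (π : Perm 3) (ch : Chain) : Set where
  constructor chain
  field
    lowest  : lookup (fun π) (proj₁ ch) ≡ zero
    middle  : lookup (fun π) (proj₁ (proj₂ ch)) ≡ suc zero
    highest : lookup (fun π) (proj₂ (proj₂ ch)) ≡ suc (suc zero)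

Ordered : Chain → (Fin 3 → ℕ) → Set
Ordered (a , b , d) t = t a < t b × t b < t d

ordered-map : ∀ ch {t t′ : Fin 3 → ℕ} → (∀ p q → t p < t q → t′ p < t′ q) →
              Ordered ch t → Ordered ch t′
ordered-map (a , b , d) h (tab , tbd) = h a b tab , h b d tbd

Occurs : ∀ {n} → Chain → (Fin n → ℕ) → Set
Occurs {n} ch s = Σ (Fin n) λ i → Σ (Fin n) λ j → Σ (Fin n) λ k →
  i F.< j × j F.< k × Ordered ch (s ∘ pick i j k)

OccursAtHead : ∀ {n} → Chain → (Fin (suc n) → ℕ) → Set
OccursAtHead {n} ch s = Σ (Fin n) λ j → Σ (Fin n) λ k →
  j F.< k × Ordered ch (s ∘ pick zero (suc j) (suc k))

values : ∀ {k n} → Vec (Fin k) n → Fin n → ℕ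
values f i = toℕ (lookup f i)

perm-injective : ∀ {n} (π : Perm n) → Injective _≡_ _≡_ (lookup (fun π))
perm-injective (perm f f-inj) e = recompute (_ FP.≟ _) (f-inj e)

chain-ordered : ∀ (π : Perm 3) {ch} → IsChainOf π ch → Ordered ch (toℕ ∘ lookup (fun π))
chain-ordered π {_ , _ , _} (chain ea eb ed) rewrite ea | eb | ed = z<s , s<s z<s

chain-inverse : ∀ (π : Perm 3) {a b d} → IsChainOf π (a , b , d) →
                ∀ p → pick a b d (lookup (fun π) p) ≡ p
chain-inverse π (chain ea eb ed) p with lookup (fun π) p in e
... | zero             = perm-injective π (trans ea (sym e))
... | suc zero         = perm-injective π (trans eb (sym e))
... | suc (suc zero)   = perm-injective π (trans ed (sym e))

contains⇒occurs : ∀ {n ch} {σ : Perm n} {π} → IsChainOf π ch → Contains σ π → Occurs ch (values (fun σ))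
contains⇒occurs {ch = ch} {σ} {π} isc (c , c-mono , c-iff) =
  c zero , c (suc zero) , c (suc (suc zero)) , c-mono _ _ z<s , c-mono _ _ (s<s z<s) ,
  ordered-map ch (λ p q lt → subst₂ _<_ (cong s (pick-eta c p)) (cong s (pick-eta c q))
                                        (Equivalence.to (c-iff p q) lt))
              (chain-ordered π isc)
  where s = values (fun σ)

occurs⇒contains : ∀ {n ch} {σ : Perm n} {π} → IsChainOf π ch → Occurs ch (values (fun σ)) → Contains σ π
occurs⇒contains {ch = a , b , d} {σ} {π} isc (i , j , k , i<j , j<k , t-ordered) =
  pick i j k , positions , λ p q → mk⇔ (embed p q) (reflect p q)
  where
  t = values (fun σ) ∘ pick i j k
  positions : ∀ p q → p F.< q → pick i j k p F.< pick i j k q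
  positions p q lt = subst₂ _<_ (sym (pick-map toℕ p)) (sym (pick-map toℕ q)) (pick-mono i<j j<k p q lt)
  embed : ∀ p q → lookup (fun π) p F.< lookup (fun π) q → t p < t q
  embed p q lt = subst₂ (λ p′ q′ → t p′ < t q′) (chain-inverse π isc p) (chain-inverse π isc q)
    (subst₂ _<_ (sym (pick-map t _)) (sym (pick-map t _))
      (pick-mono (proj₁ t-ordered) (proj₂ t-ordered) _ _ lt))
  reflect : ∀ p q → t p < t q → lookup (fun π) p F.< lookup (fun π) q
  reflect p q lt with FP.<-cmp (lookup (fun π) p) (lookup (fun π) q)
  ... | tri< πp<πq _ _ = πp<πq
  ... | tri≈ _ πp≡πq _ = ⊥-elim (ℕP.<-irrefl (cong t (perm-injective π πp≡πq)) lt)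
  ... | tri> _ _ πq<πp = ⊥-elim (ℕP.<-asym lt (embed q p πq<πp))

occurs-mono : ∀ {n} ch {s s′ : Fin n → ℕ} → (∀ x y → s x < s y → s′ x < s′ y) →
              Occurs ch s → Occurs ch s′
occurs-mono ch h (i , j , k , i<j , j<k , o) =
  i , j , k , i<j , j<k , ordered-map ch (λ p q → h (pick i j k p) (pick i j k q)) o

occurs-tail : ∀ {n} ch (s : Fin (suc n) → ℕ) → Occurs ch (s ∘ suc) → Occurs ch s
occurs-tail ch s (i , j , k , i<j , j<k , o) =
  suc i , suc j , suc k , s<s i<j , s<s j<k ,
  ordered-map ch (λ p q → subst₂ _<_ (cong s (pick-map suc p)) (cong s (pick-map suc q))) o

¬Occurs-head-tail : ∀ {n} ch (s : Fin (suc n) → ℕ) →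
                    ¬ Occurs ch (s ∘ suc) → ¬ OccursAtHead ch s → ¬ Occurs ch s
¬Occurs-head-tail ch s _ ¬head (zero , suc j , suc k , _ , s<s j<k , o) = ¬head (j , k , j<k , o)
¬Occurs-head-tail ch s ¬tail _ (suc i , suc j , suc k , s<s i<j , s<s j<k , o) =
  ¬tail (i , j , k , i<j , j<k ,
         ordered-map ch (λ p q → subst₂ _<_ (cong s (sym (pick-map suc p))) (cong s (sym (pick-map suc q)))) o)

-- Permutations of {0, …, n-1} as functions to ℕ

record IsArrangement {n} (s : Fin n → ℕ) : Set where
  field
    injective : ∀ {x y} → s x ≡ s y → x ≡ y
    bounded   : ∀ x → s x < n
    onto      : ∀ y → y < n → ∃ λ p → s p ≡ y

injective⇒surjective : ∀ {n} (f : Fin n → Fin n) → Injective _≡_ _≡_ f → ∀ y → ∃ λ p → f p ≡ y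
injective⇒surjective {suc n} f f-inj y with FP.any? (λ p → f p FP.≟ y)
... | yes found = found
... | no  none  = ⊥-elim (ℕP.<-irrefl refl (FP.injective⇒≤ g-inj))
  where
  g : Fin (suc n) → Fin n
  g p = punchOut {i = y} {j = f p} (λ e → none (p , sym e))
  g-inj : Injective _≡_ _≡_ g
  g-inj {p} {q} e = f-inj (FP.punchOut-injective {i = y} (λ e → none (p , sym e)) (λ e → none (q , sym e)) e)

values-arrangement : ∀ {n} (f : Vec (Fin n) n) → Injective _≡_ _≡_ (lookup f) → IsArrangement (values f)
values-arrangement f f-inj = record
  { injective = f-inj ∘ FP.toℕ-injective
  ; bounded   = λ x → FP.toℕ<n (lookup f x)
  ; onto      = onto
  }
  where
  onto : ∀ y → y < _ → ∃ λ p → values f p ≡ y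
  onto y y<n with p , e ← injective⇒surjective (lookup f) f-inj (F.fromℕ< y<n) =
    p , trans (cong toℕ e) (FP.toℕ-fromℕ< y<n)

located-after-two : ∀ {m} {s : Fin (suc (suc m)) → ℕ} → IsArrangement s →
                    ∀ {v} → v < suc (suc m) → v ≢ s zero → v ≢ s (suc zero) →
                    ∃ λ q → s (suc (suc q)) ≡ v
located-after-two arr v<n v≢s₀ v≢s₁ with IsArrangement.onto arr _ v<n
... | zero         , e = ⊥-elim (v≢s₀ (sym e))
... | suc zero     , e = ⊥-elim (v≢s₁ (sym e))
... | suc (suc q)  , e = q , e

-- Prepending a letter to a permutation of a smaller set

punchIn-mono-< : ∀ {n} (v : Fin (suc n)) (a b : Fin n) → a F.< b → punchIn v a F.< punchIn v b
punchIn-mono-< zero    a       b       a<b       = s<s a<b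
punchIn-mono-< (suc v) zero    (suc b) _         = z<s
punchIn-mono-< (suc v) (suc a) (suc b) (s<s a<b) = s<s (punchIn-mono-< v a b a<b)

punchIn-cancel-< : ∀ {n} (v : Fin (suc n)) (a b : Fin n) → punchIn v a F.< punchIn v b → a F.< b
punchIn-cancel-< zero    a       b       (s<s a<b) = a<b
punchIn-cancel-< (suc v) zero    (suc b) _         = z<s
punchIn-cancel-< (suc v) (suc a) (suc b) (s<s a<b) = s<s (punchIn-cancel-< v a b a<b)

punchIn-inject₁-self : ∀ {n} (h : Fin n) → punchIn (inject₁ h) h ≡ suc h
punchIn-inject₁-self zero    = refl
punchIn-inject₁-self (suc h) = cong suc (punchIn-inject₁-self h)

punchIn-suc-self : ∀ {n} (h : Fin n) → punchIn (suc h) h ≡ inject₁ h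
punchIn-suc-self zero    = refl
punchIn-suc-self (suc h) = cong suc (punchIn-suc-self h)

punchIn-successor : ∀ {m} (x : Fin (suc (suc m))) (y : Fin (suc m)) →
                    toℕ (punchIn x y) ≡ suc (toℕ x) → inject₁ y ≡ x
punchIn-successor zero zero _ = refl
punchIn-successor {suc m} (suc x) (suc y) e = cong suc (punchIn-successor x y (ℕP.suc-injective e))

punchIn-predecessor : ∀ {m} (x : Fin (suc (suc m))) (y : Fin (suc m)) →
                      toℕ x ≡ suc (toℕ (punchIn x y)) → suc y ≡ x
punchIn-predecessor (suc zero) zero _ = refl
punchIn-predecessor {suc m} (suc x) (suc y) e = cong suc (punchIn-predecessor x y (ℕP.suc-injective e))

prepend : ∀ {n k} → Fin (suc n) → Vec (Fin n) k → Vec (Fin (suc n)) (suc k)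
prepend x τ = x ∷ V.map (punchIn x) τ

prepend-injective : ∀ {n k} (x : Fin (suc n)) (τ : Vec (Fin n) k) →
                    Injective _≡_ _≡_ (lookup τ) → Injective _≡_ _≡_ (lookup (prepend x τ))
prepend-injective x τ τ-inj {zero}  {zero}  e = refl
prepend-injective x τ τ-inj {zero}  {suc j} e =
  ⊥-elim (FP.punchInᵢ≢i x (lookup τ j) (sym (trans e (VP.lookup-map j (punchIn x) τ))))
prepend-injective x τ τ-inj {suc i} {zero}  e =
  ⊥-elim (FP.punchInᵢ≢i x (lookup τ i) (trans (sym (VP.lookup-map i (punchIn x) τ)) e))
prepend-injective x τ τ-inj {suc i} {suc j} e = cong suc (τ-inj (FP.punchIn-injective x _ _
  (trans (sym (VP.lookup-map i (punchIn x) τ)) (trans e (VP.lookup-map j (punchIn x) τ)))))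

prepend-injective⁻¹ : ∀ {n k} (x : Fin (suc n)) (τ : Vec (Fin n) k) →
                      Injective _≡_ _≡_ (lookup (prepend x τ)) → Injective _≡_ _≡_ (lookup τ)
prepend-injective⁻¹ x τ inj {i} {j} e = FP.suc-injective (inj {suc i} {suc j}
  (trans (VP.lookup-map i (punchIn x) τ) (trans (cong (punchIn x) e) (sym (VP.lookup-map j (punchIn x) τ)))))

prepend-surjective : ∀ {n k} (f : Vec (Fin (suc n)) (suc k)) → Injective _≡_ _≡_ (lookup f) →
                     ∃ λ τ → prepend (V.head f) τ ≡ f
prepend-surjective (x ∷ t) inj = tabulate g , cong (x ∷_) map-punchIn-g
  where
  g : Fin _ → Fin _
  g i = punchOut {i = x} {j = lookup t i} (λ e → FP.0≢1+n (inj {zero} {suc i} e))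
  map-punchIn-g : V.map (punchIn x) (tabulate g) ≡ t
  map-punchIn-g = begin
    V.map (punchIn x) (tabulate g)  ≡⟨ VP.tabulate-∘ (punchIn x) g ⟨
    tabulate (punchIn x ∘ g)        ≡⟨ VP.tabulate-cong (λ i → FP.punchIn-punchOut _) ⟩
    tabulate (lookup t)             ≡⟨ VP.tabulate∘lookup t ⟩
    t                               ∎
    where open ≡-Reasoning

upDown-punchIn : ∀ {n m} (x : Fin (suc n)) (τ : Vec (Fin n) (suc m)) →
                 upDownᶠ (V.map (punchIn x) τ) ≡ upDownᶠ τ
upDown-punchIn x (y ∷ [])     = refl
upDown-punchIn x (y ∷ z ∷ zs) =
  cong₂ _∷_ (<ᵇ-cong (punchIn-cancel-< x y z) (punchIn-mono-< x y z)) (upDown-punchIn x (z ∷ zs))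

upDown-prepend : ∀ {n m} (x : Fin (suc n)) (τ : Vec (Fin n) (suc m)) →
                 upDownᶠ (prepend x τ) ≡
                 (values (prepend x τ) zero <ᵇ values (prepend x τ) (suc zero)) ∷ upDownᶠ τ
upDown-prepend x (y ∷ ys) = cong (_ ∷_) (upDown-punchIn x (y ∷ ys))

prepend-tail-< : ∀ {n k} (x : Fin (suc n)) (τ : Vec (Fin n) k) i j →
                 values (prepend x τ) (suc i) < values (prepend x τ) (suc j) ⇔ values τ i < values τ j
prepend-tail-< x τ i j rewrite VP.lookup-map i (punchIn x) τ | VP.lookup-map j (punchIn x) τ =
  mk⇔ (punchIn-cancel-< x _ _) (punchIn-mono-< x _ _)

-- How an avoiding permutation may begin

-- The class Av(risePattern r, fallPattern f): its members starting with an ascent obey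
-- RiseRule r, those starting with a descent obey FallRule f.
data Rise : Set where
  from-min up-by-one : Rise

data Fall : Set where
  from-max down-by-one : Fall

risePattern : Rise → Perm 3
risePattern from-min  = p231
risePattern up-by-one = p132

fallPattern : Fall → Perm 3
fallPattern from-max    = p213
fallPattern down-by-one = p312

riseChain : Rise → Chain
riseChain from-min  = suc (suc zero) , zero , suc zero
riseChain up-by-one = zero , suc (suc zero) , suc zero

fallChain : Fall → Chain
fallChain from-max    = suc zero , zero , suc (suc zero)
fallChain down-by-one = suc zero , suc (suc zero) , zero

riseChain-isChain : ∀ r → IsChainOf (risePattern r) (riseChain r)
riseChain-isChain from-min  = chain refl refl refl
riseChain-isChain up-by-one = chain refl refl refl

fallChain-isChain : ∀ f → IsChainOf (fallPattern f) (fallChain f)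
fallChain-isChain from-max    = chain refl refl refl
fallChain-isChain down-by-one = chain refl refl refl

RiseRule : Rise → ∀ {m} → (Fin (suc (suc m)) → ℕ) → Set
RiseRule from-min  s = s zero ≡ 0
RiseRule up-by-one s = s (suc zero) ≡ suc (s zero)

FallRule : Fall → ∀ {m} → (Fin (suc (suc m)) → ℕ) → Set
FallRule from-max    {m} s = s zero ≡ suc m
FallRule down-by-one     s = s zero ≡ suc (s (suc zero))

-- The first letter, given the first letter h of the standardised rest.
riseHead : Rise → ∀ {m} → Fin (suc m) → Fin (suc (suc m))
riseHead from-min  _ = zero
riseHead up-by-one h = inject₁ h

fallHead : Fall → ∀ {m} → Fin (suc m) → Fin (suc (suc m))
fallHead from-max    {m} _ = fromℕ (suc m)
fallHead down-by-one     h = suc h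

riseHead-rule : ∀ r {m} (τ : Vec (Fin (suc m)) (suc m)) →
                RiseRule r (values (prepend (riseHead r (V.head τ)) τ))
riseHead-rule from-min  τ       = refl
riseHead-rule up-by-one (y ∷ _) rewrite punchIn-inject₁-self y = cong suc (sym (FP.toℕ-inject₁ y))

fallHead-rule : ∀ f {m} (τ : Vec (Fin (suc m)) (suc m)) →
                FallRule f (values (prepend (fallHead f (V.head τ)) τ))
fallHead-rule from-max    {m} τ       = FP.toℕ-fromℕ (suc m)
fallHead-rule down-by-one     (y ∷ _) rewrite punchIn-suc-self y = cong suc (sym (FP.toℕ-inject₁ y))

riseHead-unique : ∀ r {m} x (τ : Vec (Fin (suc m)) (suc m)) →
                  RiseRule r (values (prepend x τ)) → riseHead r (V.head τ) ≡ x
riseHead-unique from-min  x τ       e = FP.toℕ-injective (sym e)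
riseHead-unique up-by-one x (y ∷ _) e = punchIn-successor x y e

fallHead-unique : ∀ f {m} x (τ : Vec (Fin (suc m)) (suc m)) →
                  FallRule f (values (prepend x τ)) → fallHead f (V.head τ) ≡ x
fallHead-unique from-max    {m} x τ       e = FP.toℕ-injective (trans (FP.toℕ-fromℕ (suc m)) (sym e))
fallHead-unique down-by-one     x (y ∷ _) e = punchIn-predecessor x y e

FirstTwoAlike : ∀ {m} → (Fin (suc (suc m)) → ℕ) → Set
FirstTwoAlike {m} s = ∀ (q : Fin m) →
  (s zero < s (suc (suc q)) → s (suc zero) < s (suc (suc q))) ×
  (s (suc (suc q)) < s zero → s (suc (suc q)) < s (suc zero))

adjacent-alike : ∀ {x x′ z} → x′ ≡ suc x ⊎ x ≡ suc x′ → z ≢ x′ →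
                 (x < z → x′ < z) × (z < x → z < x′)
adjacent-alike (inj₁ refl) z≢x′ =
  (λ x<z → ℕP.≤∧≢⇒< x<z (z≢x′ ∘ sym)) , (λ z<x → ℕP.<-trans z<x (ℕP.n<1+n _))
adjacent-alike (inj₂ refl) z≢x′ =
  (λ x<z → ℕP.<-trans (ℕP.n<1+n _) x<z) , (λ z<x → ℕP.≤∧≢⇒< (ℕP.≤-pred z<x) z≢x′)

-- An occurrence through the first letter but not the second can use the second instead.
alike-refutes : ∀ {m} ch (s : Fin (suc (suc m)) → ℕ) → FirstTwoAlike s →
                (∀ k → ¬ Ordered ch (s ∘ pick zero (suc zero) (suc (suc k)))) →
                ¬ Occurs ch (s ∘ suc) → ¬ OccursAtHead ch s
alike-refutes ch s alike ¬front ¬tail (zero  , suc k , _        , o) = ¬front k o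
alike-refutes ch s alike ¬front ¬tail (suc j , suc k , s<s j<k , o) =
  ¬tail (zero , suc j , suc k , z<s , s<s j<k , ordered-map ch replace-head o)
  where
  t  = s ∘ pick zero (suc (suc j)) (suc (suc k))
  t′ = s ∘ suc ∘ pick zero (suc j) (suc k)
  replace-head : ∀ p q → t p < t q → t′ p < t′ q
  replace-head zero             zero             lt = ⊥-elim (ℕP.<-irrefl refl lt)
  replace-head zero             (suc zero)       lt = proj₁ (alike j) lt
  replace-head zero             (suc (suc zero)) lt = proj₁ (alike k) lt
  replace-head (suc zero)       zero             lt = proj₂ (alike j) lt
  replace-head (suc (suc zero)) zero             lt = proj₂ (alike k) lt
  replace-head (suc zero)       (suc zero)       lt = lt
  replace-head (suc zero)       (suc (suc zero)) lt = lt
  replace-head (suc (suc zero)) (suc zero)       lt = lt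
  replace-head (suc (suc zero)) (suc (suc zero)) lt = lt

<-respʳ-≡ : ∀ {x y z} → y ≡ z → x < y → x < z
<-respʳ-≡ = proj₁ ℕP.<-resp₂-≡

nothing-between : ∀ {a b} → a < b → b < suc a → ⊥
nothing-between a<b b<1+a = ℕP.<⇒≱ a<b (ℕP.≤-pred b<1+a)

occurs-at-front : ∀ {m} ch (s : Fin (suc (suc m)) → ℕ) q →
                  Ordered ch (s ∘ pick zero (suc zero) (suc (suc q))) → Occurs ch s
occurs-at-front ch s q o = zero , suc zero , suc (suc q) , z<s , s<s z<s , o

module _ {m} {s : Fin (suc (suc m)) → ℕ} (arr : IsArrangement s) where
  open IsArrangement arr

  s₁≢s₀ : s (suc zero) ≢ s zero
  s₁≢s₀ = FP.0≢1+n ∘ sym ∘ injective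

  rise-rule-ascent : ∀ r → RiseRule r s → s zero < s (suc zero)
  rise-rule-ascent from-min  e =
    subst (_< s (suc zero)) (sym e) (ℕP.n≢0⇒n>0 λ s₁≡0 → s₁≢s₀ (trans s₁≡0 (sym e)))
  rise-rule-ascent up-by-one e = subst (s zero <_) (sym e) (ℕP.n<1+n _)

  fall-rule-descent : ∀ f → FallRule f s → s (suc zero) < s zero
  fall-rule-descent from-max    e = subst (s (suc zero) <_) (sym e)
    (ℕP.≤∧≢⇒< (ℕP.≤-pred (bounded (suc zero))) (λ s₁≡ → s₁≢s₀ (trans s₁≡ (sym e))))
  fall-rule-descent down-by-one e = subst (s (suc zero) <_) (sym e) (ℕP.n<1+n _)

  not-above-max : s zero ≡ suc m → ∀ x → ¬ s zero < s x
  not-above-max e x s₀<sₓ =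
    ℕP.<-irrefl refl (ℕP.<-≤-trans (subst (_< s x) e s₀<sₓ) (ℕP.≤-pred (bounded x)))

  adjacent⇒alike : s (suc zero) ≡ suc (s zero) ⊎ s zero ≡ suc (s (suc zero)) → FirstTwoAlike s
  adjacent⇒alike adjacent q = adjacent-alike adjacent (FP.0≢1+n ∘ sym ∘ FP.suc-injective ∘ injective)

  rise-refutes-rise : ∀ r → RiseRule r s →
                      ¬ Occurs (riseChain r) (s ∘ suc) → ¬ OccursAtHead (riseChain r) s
  rise-refutes-rise from-min  e _ (_ , _ , _ , z<s₀ , _) = ℕP.n≮0 (<-respʳ-≡ e z<s₀)
  rise-refutes-rise up-by-one e = alike-refutes _ s (adjacent⇒alike (inj₁ e))
    λ _ (s₀<z , z<s₁) → nothing-between s₀<z (<-respʳ-≡ e z<s₁)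

  rise-refutes-fall : ∀ r f → RiseRule r s →
                      ¬ Occurs (fallChain f) (s ∘ suc) → ¬ OccursAtHead (fallChain f) s
  rise-refutes-fall from-min  from-max    e _ (_ , _ , _ , z<s₀ , _) = ℕP.n≮0 (<-respʳ-≡ e z<s₀)
  rise-refutes-fall from-min  down-by-one e _ (_ , _ , _ , _ , z<s₀) = ℕP.n≮0 (<-respʳ-≡ e z<s₀)
  rise-refutes-fall up-by-one from-max    e = alike-refutes _ s (adjacent⇒alike (inj₁ e))
    λ _ (s₁<s₀ , _) → ℕP.<-asym s₁<s₀ (rise-rule-ascent up-by-one e)
  rise-refutes-fall up-by-one down-by-one e = alike-refutes _ s (adjacent⇒alike (inj₁ e))
    λ _ (s₁<z , z<s₀) → ℕP.<-asym (ℕP.<-trans s₁<z z<s₀) (rise-rule-ascent up-by-one e)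

  fall-refutes-fall : ∀ f → FallRule f s →
                      ¬ Occurs (fallChain f) (s ∘ suc) → ¬ OccursAtHead (fallChain f) s
  fall-refutes-fall from-max    e _ (_ , k , _ , _ , s₀<z) = not-above-max e (suc k) s₀<z
  fall-refutes-fall down-by-one e = alike-refutes _ s (adjacent⇒alike (inj₂ e))
    λ _ (s₁<z , z<s₀) → nothing-between s₁<z (<-respʳ-≡ e z<s₀)

  fall-refutes-rise : ∀ f r → FallRule f s →
                      ¬ Occurs (riseChain r) (s ∘ suc) → ¬ OccursAtHead (riseChain r) s
  fall-refutes-rise from-max    from-min  e _ (j , _ , _ , _ , s₀<z) = not-above-max e (suc j) s₀<z
  fall-refutes-rise from-max    up-by-one e _ (_ , k , _ , s₀<z , _) = not-above-max e (suc k) s₀<z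
  fall-refutes-rise down-by-one from-min  e = alike-refutes _ s (adjacent⇒alike (inj₂ e))
    λ _ (_ , s₀<s₁) → ℕP.<-asym s₀<s₁ (fall-rule-descent down-by-one e)
  fall-refutes-rise down-by-one up-by-one e = alike-refutes _ s (adjacent⇒alike (inj₂ e))
    λ _ (s₀<z , z<s₁) → ℕP.<-asym (ℕP.<-trans s₀<z z<s₁) (fall-rule-descent down-by-one e)

  -- Otherwise the value the rule asks for sits at some later position, where it forms an
  -- occurrence with the first two letters.
  rise-rule-forced : ∀ r → s zero < s (suc zero) → ¬ Occurs (riseChain r) s → RiseRule r s
  rise-rule-forced from-min s₀<s₁ ¬occ = decidable-stable (s zero ℕ.≟ 0) λ s₀≢0 →
    let q , e = located-after-two arr z<s (s₀≢0 ∘ sym)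
                  (λ 0≡s₁ → ℕP.n≮0 (subst (s zero <_) (sym 0≡s₁) s₀<s₁))
    in ¬occ (occurs-at-front (riseChain from-min) s q
               (subst (_< s zero) (sym e) (ℕP.n≢0⇒n>0 s₀≢0) , s₀<s₁))
  rise-rule-forced up-by-one s₀<s₁ ¬occ = decidable-stable (s (suc zero) ℕ.≟ suc (s zero)) λ s₁≢ →
    let 1+s₀<s₁ = ℕP.≤∧≢⇒< s₀<s₁ (s₁≢ ∘ sym)
        q , e   = located-after-two arr (ℕP.<-trans 1+s₀<s₁ (bounded (suc zero))) ℕP.1+n≢n (s₁≢ ∘ sym)
    in ¬occ (occurs-at-front (riseChain up-by-one) s q
               (subst (s zero <_) (sym e) (ℕP.n<1+n _) , subst (_< s (suc zero)) (sym e) 1+s₀<s₁))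

  fall-rule-forced : ∀ f → s (suc zero) < s zero → ¬ Occurs (fallChain f) s → FallRule f s
  fall-rule-forced from-max s₁<s₀ ¬occ = decidable-stable (s zero ℕ.≟ suc m) λ s₀≢ →
    let s₀<1+m = ℕP.≤∧≢⇒< (ℕP.≤-pred (bounded zero)) s₀≢
        q , e  = located-after-two arr (ℕP.n<1+n _) (s₀≢ ∘ sym)
                   (λ 1+m≡s₁ → ℕP.<-asym s₁<s₀ (subst (s zero <_) 1+m≡s₁ s₀<1+m))
    in ¬occ (occurs-at-front (fallChain from-max) s q (s₁<s₀ , subst (s zero <_) (sym e) s₀<1+m))
  fall-rule-forced down-by-one s₁<s₀ ¬occ = decidable-stable (s zero ℕ.≟ suc (s (suc zero))) λ s₀≢ →
    let 1+s₁<s₀ = ℕP.≤∧≢⇒< s₁<s₀ (s₀≢ ∘ sym)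
        q , e   = located-after-two arr (ℕP.<-trans 1+s₁<s₀ (bounded zero)) (s₀≢ ∘ sym) ℕP.1+n≢n
    in ¬occ (occurs-at-front (fallChain down-by-one) s q
               (subst (s (suc zero) <_) (sym e) (ℕP.n<1+n _) , subst (_< s zero) (sym e) 1+s₁<s₀))

-- Each class is in bijection with the ballot words

record BallotWord (m : ℕ) : Set where
  constructor mkBallotWord
  field
    steps     : Vec Bool m
    .isBallot : IsBallotWord steps

BallotWord-ext : ∀ {m} {u v : BallotWord m} → BallotWord.steps u ≡ BallotWord.steps v → u ≡ v
BallotWord-ext {u = mkBallotWord w _} {mkBallotWord .w _} refl = refl

B-ext : ∀ {n π₁ π₂} {x y : B n π₁ π₂} → fun (B.perm-of x) ≡ fun (B.perm-of y) → x ≡ y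
B-ext {x = mkB (perm f _) _ _ _} {mkB (perm .f _) _ _ _} refl = refl

B-swap : ∀ {n π₁ π₂} → B n π₁ π₂ ↔ B n π₂ π₁
B-swap = mk↔ₛ′ swap swap (λ _ → refl) (λ _ → refl)
  where
  swap : ∀ {n π₁ π₂} → B n π₁ π₂ → B n π₂ π₁
  swap (mkB σ ballot av₁ av₂) = mkB σ ballot av₂ av₁

¬Occurs-in-singleton : ∀ ch (s : Fin 1 → ℕ) → ¬ Occurs ch s
¬Occurs-in-singleton ch s (zero , zero , zero , () , _)

module Decoding (r : Rise) (f : Fall) where

  Rule : Bool → ∀ {m} → (Fin (suc (suc m)) → ℕ) → Set
  Rule true  = RiseRule r
  Rule false = FallRule f

  firstLetter : Bool → ∀ {m} → Fin (suc m) → Fin (suc (suc m))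
  firstLetter true  = riseHead r
  firstLetter false = fallHead f

  Avoiding : ∀ {n} → (Fin n → ℕ) → Set
  Avoiding s = ¬ Occurs (riseChain r) s × ¬ Occurs (fallChain f) s

  avoiding⇔ : ∀ {n} (σ : Perm n) →
              (Avoids σ (risePattern r) × Avoids σ (fallPattern f)) ⇔ Avoiding (values (fun σ))
  avoiding⇔ σ = mk⇔
    (λ (av₁ , av₂) → av₁ ∘ occurs⇒contains {σ = σ} (riseChain-isChain r) ,
                     av₂ ∘ occurs⇒contains {σ = σ} (fallChain-isChain f))
    (λ (¬r , ¬f) → ¬r ∘ contains⇒occurs {σ = σ} (riseChain-isChain r) ,
                   ¬f ∘ contains⇒occurs {σ = σ} (fallChain-isChain f))

  firstLetter-rule : ∀ b {m} (τ : Vec (Fin (suc m)) (suc m)) →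
                     Rule b (values (prepend (firstLetter b (V.head τ)) τ))
  firstLetter-rule true  = riseHead-rule r
  firstLetter-rule false = fallHead-rule f

  firstLetter-unique : ∀ b {m} x (τ : Vec (Fin (suc m)) (suc m)) →
                       Rule b (values (prepend x τ)) → firstLetter b (V.head τ) ≡ x
  firstLetter-unique true  = riseHead-unique r
  firstLetter-unique false = fallHead-unique f

  rule-step : ∀ b {m} {s : Fin (suc (suc m)) → ℕ} → IsArrangement s → Rule b s →
              (s zero <ᵇ s (suc zero)) ≡ b
  rule-step true  arr e = <ᵇ-true (rise-rule-ascent arr r e)
  rule-step false arr e = <ᵇ-false (ℕP.<⇒≯ (fall-rule-descent arr f e))

  rule-avoiding : ∀ b {m} {s : Fin (suc (suc m)) → ℕ} → IsArrangement s → Rule b s →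
                  Avoiding (s ∘ suc) → Avoiding s
  rule-avoiding true  {s = s} arr e (¬r , ¬f) =
    ¬Occurs-head-tail (riseChain r) s ¬r (rise-refutes-rise arr r e ¬r) ,
    ¬Occurs-head-tail (fallChain f) s ¬f (rise-refutes-fall arr r f e ¬f)
  rule-avoiding false {s = s} arr e (¬r , ¬f) =
    ¬Occurs-head-tail (riseChain r) s ¬r (fall-refutes-rise arr f r e ¬r) ,
    ¬Occurs-head-tail (fallChain f) s ¬f (fall-refutes-fall arr f e ¬f)

  rule-forced : ∀ {m} {s : Fin (suc (suc m)) → ℕ} → IsArrangement s → Avoiding s →
                Rule (s zero <ᵇ s (suc zero)) s
  rule-forced {s = s} arr (¬r , ¬f)
    with s zero <ᵇ s (suc zero) | ℕP.<ᵇ-reflects-< (s zero) (s (suc zero))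
  ... | true  | ofʸ s₀<s₁ = rise-rule-forced arr r s₀<s₁ ¬r
  ... | false | ofⁿ s₀≮s₁ = fall-rule-forced arr f (ℕP.≤∧≢⇒< (ℕP.≮⇒≥ s₀≮s₁) (s₁≢s₀ arr)) ¬f

  avoiding-prepend-tail : ∀ {n k} (x : Fin (suc n)) (τ : Vec (Fin n) k) →
                          Avoiding (values τ) → Avoiding (values (prepend x τ) ∘ suc)
  avoiding-prepend-tail x τ (¬r , ¬f) = ¬r ∘ occurs-mono (riseChain r) to , ¬f ∘ occurs-mono (fallChain f) to
    where to = λ i j → Equivalence.to (prepend-tail-< x τ i j)

  avoiding-prepend⁻¹ : ∀ {n k} (x : Fin (suc n)) (τ : Vec (Fin n) k) →
                       Avoiding (values (prepend x τ)) → Avoiding (values τ)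
  avoiding-prepend⁻¹ x τ (¬r , ¬f) = ¬r ∘ embed , ¬f ∘ embed
    where
    embed : ∀ {ch} → Occurs ch (values τ) → Occurs ch (values (prepend x τ))
    embed {ch} = occurs-tail ch (values (prepend x τ)) ∘
                 occurs-mono ch (λ i j → Equivalence.from (prepend-tail-< x τ i j))

  decode : ∀ {m} → Vec Bool m → Vec (Fin (suc m)) (suc m)
  decode []      = zero ∷ []
  decode (b ∷ w) = prepend (firstLetter b (V.head (decode w))) (decode w)

  decode-injective : ∀ {m} (w : Vec Bool m) → Injective _≡_ _≡_ (lookup (decode w))
  decode-injective []      {zero} {zero} _ = refl
  decode-injective (b ∷ w) = prepend-injective _ (decode w) (decode-injective w)

  decode-arrangement : ∀ {m} (w : Vec Bool m) → IsArrangement (values (decode w))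
  decode-arrangement w = values-arrangement (decode w) (decode-injective w)

  decode-avoiding : ∀ {m} (w : Vec Bool m) → Avoiding (values (decode w))
  decode-avoiding []      =
    ¬Occurs-in-singleton (riseChain r) (values (zero ∷ [])) ,
    ¬Occurs-in-singleton (fallChain f) (values (zero ∷ []))
  decode-avoiding (b ∷ w) =
    rule-avoiding b (decode-arrangement (b ∷ w)) (firstLetter-rule b (decode w))
      (avoiding-prepend-tail _ (decode w) (decode-avoiding w))

  upDown-decode : ∀ {m} (w : Vec Bool m) → upDownᶠ (decode w) ≡ w
  upDown-decode []      = refl
  upDown-decode (b ∷ w) = trans (upDown-prepend _ (decode w))
    (cong₂ _∷_ (rule-step b (decode-arrangement (b ∷ w)) (firstLetter-rule b (decode w)))
               (upDown-decode w))

  decode-upDown : ∀ {m} (g : Vec (Fin (suc m)) (suc m)) → Injective _≡_ _≡_ (lookup g) →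
                  Avoiding (values g) → decode (upDownᶠ g) ≡ g
  decode-upDown {zero}  (zero ∷ []) _     _  = refl
  decode-upDown {suc m} (x ∷ t)     g-inj av with prepend-surjective (x ∷ t) g-inj
  ... | τ , refl = begin
    decode (upDownᶠ (prepend x τ))          ≡⟨ cong decode (upDown-prepend x τ) ⟩
    prepend (firstLetter b (V.head τ′)) τ′  ≡⟨ cong (λ υ → prepend (firstLetter b (V.head υ)) υ) τ′≡τ ⟩
    prepend (firstLetter b (V.head τ)) τ    ≡⟨ cong (λ y → prepend y τ) first-unique ⟩
    prepend x τ                             ∎
    where
    open ≡-Reasoning
    b = values (prepend x τ) zero <ᵇ values (prepend x τ) (suc zero)
    τ′ = decode (upDownᶠ τ)
    τ′≡τ = decode-upDown τ (prepend-injective⁻¹ x τ g-inj) (avoiding-prepend⁻¹ x τ av)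
    first-unique = firstLetter-unique b x τ (rule-forced (values-arrangement (prepend x τ) g-inj) av)

  class↔ballotWords : ∀ m → B (suc m) (risePattern r) (fallPattern f) ↔ BallotWord m
  class↔ballotWords m = mk↔ₛ′ to from to∘from from∘to
    where
    decoded : Vec Bool m → Perm (suc m)
    decoded w = perm (decode w) (decode-injective w)
    to : B (suc m) (risePattern r) (fallPattern f) → BallotWord m
    to (mkB σ ballot _ _) = mkBallotWord (upDownᶠ (fun σ)) (Equivalence.to (ballot⇔ σ) ballot)
    from : BallotWord m → B (suc m) (risePattern r) (fallPattern f)
    from (mkBallotWord w ballot) = mkB (decoded w)
      (Equivalence.from (ballot⇔ (decoded w)) (subst IsBallotWord (sym (upDown-decode w)) ballot))
      (proj₁ avoids) (proj₂ avoids)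
      where avoids = Equivalence.from (avoiding⇔ (decoded w)) (decode-avoiding w)
    to∘from : ∀ w → to (from w) ≡ w
    to∘from (mkBallotWord w _) = BallotWord-ext (upDown-decode w)
    from∘to : ∀ x → from (to x) ≡ x
    from∘to (mkB (perm g g-inj) _ av₁ av₂) = B-ext (recompute (VP.≡-dec FP._≟_ _ _)
      (decode-upDown g g-inj (Equivalence.to (avoiding⇔ (perm g g-inj)) (av₁ , av₂))))

open Decoding using (class↔ballotWords)

theorem3p4 : (n : ℕ) → 1 ≤ n →
    (B n p132 p213 ≈ᶜ B n p213 p231) ×
    (B n p213 p231 ≈ᶜ B n p231 p312) ×
    (B n p231 p312 ≈ᶜ B n p132 p312)
theorem3p4 (suc m) _ =
    ↔-trans Av132,213 (↔-sym Av213,231)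
  , ↔-trans Av213,231 (↔-sym Av231,312)
  , ↔-trans Av231,312 (↔-sym Av132,312)
  where
  Av132,213 = class↔ballotWords up-by-one from-max m
  Av213,231 = ↔-trans B-swap (class↔ballotWords from-min from-max m)
  Av231,312 = class↔ballotWords from-min down-by-one m
  Av132,312 = class↔ballotWords up-by-one down-by-one m
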